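{- Let $n\geq 2$. Let $R_{\Gamma_n}$ (respectively $L_{\Gamma_n}$) be the set of ordered pairs $(e,e')$ of edges of $\Gamma_n$ such that, if $e=\{x,y\}$ uses direction $i$ with lower endpoint $y$ and upper endpoint $x=y+\delta_i$, then $e'=\{y,y+\delta_{i+1}\}$ (respectively $e'=\{y,y+\delta_{i-1}\}$) is an edge of $\Gamma_n$ that is an imbalanced edge for $e$. Then there is a bijection between $R_{\Gamma_n}$ and $E(\Gamma_{n-1})$, and there is a bijection between $L_{\Gamma_n}$ and $E(\Gamma_{n-1})$.
   Context: The hypercube $Q_n$ has vertex set the binary strings of length $n$, two strings being adjacent iff they differ in exactly one position. For a binary string $x=x_1\ldots x_n$ and $i\in[1,n]$, $x+\delta_i$ denotes the string obtained from $x$ by complementing the $i$-th coordinate; the edge $\{x,x+\delta_i\}$ uses direction $i$. A Fibonacci string is a binary string with no two consecutive 1's; $\Gamma_n$ is the subgraph of $Q_n$ induced by the Fibonacci strings of length $n$. For an edge $e=\{x,y\}$ using direction $i$, the endpoint with $i$-th coordinate 1 is the upper endpoint and the other the lower endpoint. An edge $e'=\{y,y+\delta_j\}$ of $\Gamma_n$ at the lower endpoint $y$ of $e=\{x,y\}$ is an imbalanced edge for $e$ if $x+\delta_j$ is not a Fibonacci string. -}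

module Defs where

open import Data.Bool using (Bool; true; false; not; _∧_)
open import Data.Nat using (ℕ; zero; suc)
open import Data.Fin using (Fin; zero; suc; toℕ)
open import Data.Vec using (Vec; []; _∷_; lookup)
open import Data.Product using (Σ; _×_; _,_)
open import Data.Sum using (_⊎_)
open import Relation.Binary.PropositionalEquality using (_≡_)

-- Binary strings of length n are Vec Bool n (true = 1, false = 0).
-- Coordinates are indexed by Fin n (0-based: coordinate i here is i+1 in the paper).

flip : ∀ {n} → Vec Bool n → Fin n → Vec Bool n
flip (b ∷ xs) zero    = not b ∷ xs
flip (b ∷ xs) (suc i) = b ∷ flip xs i

fib : ∀ {n} → Vec Bool n → Bool
fib []               = true
fib (a ∷ [])         = true
fib (a ∷ b ∷ xs)     = not (a ∧ b) ∧ fib (b ∷ xs)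

IsFib : ∀ {n} → Vec Bool n → Set
IsFib x = fib x ≡ true

NotFib : ∀ {n} → Vec Bool n → Set
NotFib x = fib x ≡ false

-- An edge of Γ_n, represented uniquely by its upper endpoint x and its
-- direction i: x has i-th coordinate 1, and both endpoints x and x + δ_i
-- are Fibonacci strings.
Edge : ℕ → Set
Edge n = Σ (Vec Bool n) λ x → Σ (Fin n) λ i →
           (lookup x i ≡ true) × IsFib x × IsFib (flip x i)

upper : ∀ {n} → Edge n → Vec Bool n
upper (x , _ , _) = x

dir : ∀ {n} → Edge n → Fin n
dir (_ , i , _) = i

lower : ∀ {n} → Edge n → Vec Bool n
lower (x , i , _) = flip x i

IsEdgeAt : ∀ {n} → Edge n → Vec Bool n → Fin n → Set
IsEdgeAt e' y j = (dir e' ≡ j) × ((upper e' ≡ y) ⊎ (upper e' ≡ flip y j))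

-- (e , e') where e' = {y , y + δ_j}, y the lower endpoint of e, and e' is an
-- imbalanced edge for e (x + δ_j is not a Fibonacci string, x upper endpoint of e)
ImbalancedVia : ∀ {n} → Edge n → Edge n → Fin n → Set
ImbalancedVia e e' j = IsEdgeAt e' (lower e) j × NotFib (flip (upper e) j)

R : ℕ → Set
R n = Σ (Edge n × Edge n) λ { (e , e') →
        Σ (Fin n) λ j → (toℕ j ≡ suc (toℕ (dir e))) × ImbalancedVia e e' j }

L : ℕ → Set
L n = Σ (Edge n × Edge n) λ { (e , e') →
        Σ (Fin n) λ j → (toℕ (dir e) ≡ suc (toℕ j)) × ImbalancedVia e e' j }

-- Let e have upper endpoint x and direction i. As x is Fibonacci it reads 10 at (i, i + 1), so
-- the only possible partner in R is the edge whose upper endpoint x′ is x with that 1 moved to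
-- i + 1, and it is always imbalanced because x + δ_{i+1} contains 11. Deleting the 0 beside the 1
-- turns both x and x′ into the same string z of length n - 1 with a 1 at i, and z is Fibonacci
-- iff both ways of inserting a 0 beside that 1 (namely x and x′) are. Hence deleting and
-- re-inserting that 0 are inverse bijections between R and the edges of Γ_{n-1}; L is the mirror
-- image.

module Submission where

open import Defs
open import Data.Bool using (Bool; true; false; not)
import Data.Bool as Bool
open import Data.Bool.Properties using () renaming (_≟_ to _≟ᵇ_)
open import Data.Nat using (ℕ; zero; suc; _≤_; _∸_; s≤s)
open import Data.Nat.Properties using (suc-injective) renaming (≡-irrelevant to ℕ-≡-irrelevant)
open import Data.Fin using (Fin; zero; suc; toℕ; inject₁; punchIn)
open import Data.Fin.Properties using (toℕ-injective; toℕ-inject₁; punchInᵢ≢i)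
open import Data.Vec using (Vec; []; _∷_; lookup; insertAt; removeAt; updateAt)
open import Data.Vec.Properties
  using ( insertAt-lookup; insertAt-punchIn; insertAt-removeAt; removeAt-insertAt
        ; lookup∘updateAt; lookup∘updateAt′)
open import Data.Vec.Relation.Binary.Pointwise.Inductive using (Pointwise; []; _∷_)
  renaming (refl to Pointwise-refl)
open import Data.Product using (Σ; _×_; _,_; proj₁)
open import Data.Sum using (inj₁; inj₂)
open import Data.Empty using (⊥; ⊥-elim)
open import Function.Bundles using (_⤖_; mk↔ₛ′)
open import Function.Properties.Inverse using (↔⇒⤖)
open import Relation.Nullary using (Irrelevant)
open import Relation.Binary.PropositionalEquality
open import Axiom.UniquenessOfIdentityProofs using (module Decidable⇒UIP)

private
  variable
    m n : ℕ

Bool-≡-irrelevant : {a b : Bool} → Irrelevant (a ≡ b)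
Bool-≡-irrelevant = Decidable⇒UIP.≡-irrelevant _≟ᵇ_

flip-≡-updateAt : (x : Vec Bool n) (i : Fin n) → flip x i ≡ updateAt x i not
flip-≡-updateAt (b ∷ x) zero    = refl
flip-≡-updateAt (b ∷ x) (suc i) = cong (b ∷_) (flip-≡-updateAt x i)

lookup-flip : (x : Vec Bool n) (i : Fin n) → lookup (flip x i) i ≡ not (lookup x i)
lookup-flip x i rewrite flip-≡-updateAt x i = lookup∘updateAt i x

lookup-flip-≢ : (x : Vec Bool n) {i j : Fin n} → i ≢ j → lookup (flip x j) i ≡ lookup x i
lookup-flip-≢ x {i} {j} i≢j rewrite flip-≡-updateAt x j = lookup∘updateAt′ i j i≢j x

data Adjacent {m} (k : Fin m) : Fin (suc m) → Fin (suc m) → Set where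
  rightward : Adjacent k (inject₁ k) (suc k)
  leftward  : Adjacent k (suc k) (inject₁ k)

private
  variable
    k : Fin m
    p q : Fin (suc m)

adjacent-sym : Adjacent k p q → Adjacent k q p
adjacent-sym rightward = leftward
adjacent-sym leftward  = rightward

punchIn-adjacent : Adjacent k p q → punchIn q k ≡ p
punchIn-adjacent {k = zero}  rightward = refl
punchIn-adjacent {k = zero}  leftward  = refl
punchIn-adjacent {k = suc k} rightward = cong suc (punchIn-adjacent {k = k} rightward)
punchIn-adjacent {k = suc k} leftward  = cong suc (punchIn-adjacent {k = k} leftward)

adjacent-≢ : Adjacent k p q → p ≢ q
adjacent-≢ {k = k} {q = q} s p≡q = punchInᵢ≢i q k (trans (punchIn-adjacent s) p≡q)

toℕ-≡⇒inject₁ : {i : Fin (suc m)} → toℕ k ≡ toℕ i → i ≡ inject₁ k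
toℕ-≡⇒inject₁ {k = k} k≡i = toℕ-injective (trans (sym k≡i) (sym (toℕ-inject₁ k)))

adjacent-rightward : {i : Fin (suc m)} → toℕ k ≡ toℕ i → Adjacent k i (suc k)
adjacent-rightward k≡i with refl ← toℕ-≡⇒inject₁ k≡i = rightward

adjacent-leftward : {j : Fin (suc m)} → toℕ k ≡ toℕ j → Adjacent k (suc k) j
adjacent-leftward k≡j with refl ← toℕ-≡⇒inject₁ k≡j = leftward

lookup-insertAt-adjacent : Adjacent k p q → (z : Vec Bool m) (b : Bool) →
                           lookup (insertAt z q b) p ≡ lookup z k
lookup-insertAt-adjacent {k = k} {q = q} s z b =
  subst (λ i → lookup (insertAt z q b) i ≡ lookup z k) (punchIn-adjacent s) (insertAt-punchIn z q b k)

lookup-removeAt-adjacent : Adjacent k p q → (x : Vec Bool (suc m)) →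
                           lookup (removeAt x q) k ≡ lookup x p
lookup-removeAt-adjacent {k = k} {p = p} {q = q} s x = begin
  lookup (removeAt x q) k
    ≡⟨ lookup-insertAt-adjacent s (removeAt x q) (lookup x q) ⟨
  lookup (insertAt (removeAt x q) q (lookup x q)) p
    ≡⟨ cong (λ y → lookup y p) (insertAt-removeAt x q) ⟩
  lookup x p
    ∎
  where open ≡-Reasoning

-- The 1 of z at k hops over the 0 inserted next to it.
hop : Adjacent k p q → (z : Vec Bool m) → lookup z k ≡ true →
      flip (flip (insertAt z q false) p) q ≡ insertAt z p false
hop {k = zero}  rightward (true ∷ z) refl = refl
hop {k = zero}  leftward  (true ∷ z) refl = refl
hop {k = suc k} rightward (a ∷ z)    zₖ   = cong (a ∷_) (hop rightward z zₖ)
hop {k = suc k} leftward  (a ∷ z)    zₖ   = cong (a ∷_) (hop leftward z zₖ)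

fib-tail : (a : Bool) (x : Vec Bool n) → IsFib (a ∷ x) → IsFib x
fib-tail _     []          _ = refl
fib-tail false (_ ∷ _)     h = h
fib-tail true  (false ∷ _) h = h
fib-tail true  (true ∷ _)  ()

fib-false∷ : (x : Vec Bool n) → IsFib x → IsFib (false ∷ x)
fib-false∷ []      _ = refl
fib-false∷ (_ ∷ _) h = h

notFib-∷ : (a : Bool) (x : Vec Bool (suc n)) → NotFib x → NotFib (a ∷ x)
notFib-∷ false (_ ∷ _)     h = h
notFib-∷ true  (false ∷ _) h = h
notFib-∷ true  (true ∷ _)  _ = refl

fib-antitone : {u v : Vec Bool n} → Pointwise Bool._≤_ u v → IsFib v → IsFib u
fib-antitone []                                    _ = refl
fib-antitone {u = false ∷ u} {c ∷ v}        (_ ∷ ≤s) h =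
  fib-false∷ u (fib-antitone ≤s (fib-tail c v h))
fib-antitone {u = true ∷ []}                (_ ∷ []) _ = refl
fib-antitone {u = true ∷ false ∷ u} {c ∷ v} (_ ∷ ≤s) h = fib-antitone ≤s (fib-tail c v h)
fib-antitone {u = true ∷ true ∷ _} (Bool.b≤b ∷ Bool.b≤b ∷ _) ()

flip-one-≤ : (x : Vec Bool n) (i : Fin n) → lookup x i ≡ true → Pointwise Bool._≤_ (flip x i) x
flip-one-≤ (true ∷ x) zero    refl = Bool.f≤t ∷ Pointwise-refl Bool.b≤b
flip-one-≤ (a ∷ x)    (suc i) xᵢ   = Bool.b≤b ∷ flip-one-≤ x i xᵢ

fib-flip-one : (x : Vec Bool n) (i : Fin n) → lookup x i ≡ true → IsFib x → IsFib (flip x i)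
fib-flip-one x i xᵢ = fib-antitone (flip-one-≤ x i xᵢ)

adjacent-ones-notFib : Adjacent k p q → (x : Vec Bool (suc m)) →
                       lookup x p ≡ true → lookup x q ≡ true → NotFib x
adjacent-ones-notFib {k = zero}  rightward (true ∷ true ∷ _) refl refl = refl
adjacent-ones-notFib {k = zero}  leftward  (true ∷ true ∷ _) refl refl = refl
adjacent-ones-notFib {k = suc k} rightward (a ∷ x) xₚ x_q =
  notFib-∷ a x (adjacent-ones-notFib rightward x xₚ x_q)
adjacent-ones-notFib {k = suc k} leftward  (a ∷ x) xₚ x_q =
  notFib-∷ a x (adjacent-ones-notFib leftward x xₚ x_q)

fib-adjacent-zero : Adjacent k p q → (x : Vec Bool (suc m)) →
                    IsFib x → lookup x p ≡ true → lookup x q ≡ false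
fib-adjacent-zero {q = q} s x fx xₚ with lookup x q in x_q
... | false = refl
... | true with () ← trans (sym fx) (adjacent-ones-notFib s x xₚ x_q)

fib-insertAt-false : (z : Vec Bool n) (i : Fin (suc n)) → IsFib z → IsFib (insertAt z i false)
fib-insertAt-false z                  zero          fz = fib-false∷ z fz
fib-insertAt-false (false ∷ z)        (suc zero)    fz = fib-false∷ z (fib-tail false z fz)
fib-insertAt-false (true ∷ z)         (suc zero)    fz = fib-false∷ z (fib-tail true z fz)
fib-insertAt-false (false ∷ z)        (suc (suc i)) fz =
  fib-false∷ (insertAt z (suc i) false) (fib-insertAt-false z (suc i) (fib-tail false z fz))
fib-insertAt-false (true ∷ false ∷ z) (suc (suc i)) fz =
  fib-insertAt-false (false ∷ z) (suc i) (fib-tail true (false ∷ z) fz)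
fib-insertAt-false (true ∷ true ∷ _)  (suc (suc _)) ()

-- Every adjacent pair of z stays adjacent in one of the two padded strings.
fib-of-padded : Adjacent k p q → (z : Vec Bool m) →
                IsFib (insertAt z p false) → IsFib (insertAt z q false) → IsFib z
fib-of-padded rightward z f g = fib-of-paddedʳ z _ f g
  where
  fib-of-paddedʳ : (z : Vec Bool m) (k : Fin m) →
                   IsFib (insertAt z (inject₁ k) false) → IsFib (insertAt z (suc k) false) → IsFib z
  fib-of-paddedʳ (a ∷ z)                zero    f _ = fib-tail false (a ∷ z) f
  fib-of-paddedʳ (false ∷ z@(_ ∷ _))    (suc k) f g =
    fib-of-paddedʳ z k (fib-tail false (insertAt z (inject₁ k) false) f)
                       (fib-tail false (insertAt z (suc k) false) g)
  fib-of-paddedʳ (true ∷ z@(false ∷ _)) (suc k) f g =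
    fib-of-paddedʳ z k (fib-tail true (insertAt z (inject₁ k) false) f)
                       (fib-tail true (insertAt z (suc k) false) g)
  fib-of-paddedʳ (true ∷ true ∷ _)      (suc _) _ ()
fib-of-padded leftward z f g = fib-of-padded rightward z g f

edge : (x : Vec Bool n) (i : Fin n) → lookup x i ≡ true → IsFib x → Edge n
edge x i xᵢ fx = x , i , xᵢ , fx , fib-flip-one x i xᵢ fx

Edge-≡ : {e e′ : Edge n} → upper e ≡ upper e′ → dir e ≡ dir e′ → e ≡ e′
Edge-≡ {e = x , i , a , b , c} {.x , .i , a′ , b′ , c′} refl refl
  rewrite Bool-≡-irrelevant a a′ | Bool-≡-irrelevant b b′ | Bool-≡-irrelevant c c′ = refl

flip-ones-⊥ : (y : Vec Bool n) (j : Fin n) → lookup y j ≡ true → lookup (flip y j) j ≡ true → ⊥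
flip-ones-⊥ y j yⱼ y′ⱼ with () ← trans (sym y′ⱼ) (trans (lookup-flip y j) (cong not yⱼ))

-- Only one of y and y + δ_j has a 1 at j, and that one is the upper endpoint.
isEdgeAt-unique : {e₁ e₂ : Edge n} {y : Vec Bool n} {j : Fin n} →
                  IsEdgeAt e₁ y j → IsEdgeAt e₂ y j → e₁ ≡ e₂
isEdgeAt-unique {e₁ = _ , _ , _} {_ , _ , _} (refl , inj₁ refl) (refl , inj₁ refl) = Edge-≡ refl refl
isEdgeAt-unique {e₁ = _ , _ , _} {_ , _ , _} (refl , inj₂ refl) (refl , inj₂ refl) = Edge-≡ refl refl
isEdgeAt-unique {e₁ = _ , j , y₁ , _} {_ , _ , y₂ , _} {y} (refl , inj₁ refl) (refl , inj₂ refl) =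
  ⊥-elim (flip-ones-⊥ y j y₁ y₂)
isEdgeAt-unique {e₁ = _ , j , y₁ , _} {_ , _ , y₂ , _} {y} (refl , inj₂ refl) (refl , inj₁ refl) =
  ⊥-elim (flip-ones-⊥ y j y₂ y₁)

isEdgeAt-irrelevant : {e : Edge n} {y : Vec Bool n} {j : Fin n} → Irrelevant (IsEdgeAt e y j)
isEdgeAt-irrelevant {e = _ , _ , _} (refl , inj₁ refl) (refl , inj₁ refl) = refl
isEdgeAt-irrelevant {e = _ , _ , _} (refl , inj₂ refl) (refl , inj₂ refl) = refl
isEdgeAt-irrelevant {e = _ , j , xⱼ , _} {y} (refl , inj₁ refl) (refl , inj₂ eq) =
  ⊥-elim (flip-ones-⊥ y j xⱼ (subst (λ v → lookup v j ≡ true) eq xⱼ))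
isEdgeAt-irrelevant {e = _ , j , xⱼ , _} {y} (refl , inj₂ refl) (refl , inj₁ eq) =
  ⊥-elim (flip-ones-⊥ y j (subst (λ v → lookup v j ≡ true) eq xⱼ) xⱼ)

-- R and L are both of this shape, for C i j meaning j = i + 1 resp. i = j + 1.
ImbalancedPairs : (n : ℕ) → (Fin n → Fin n → Set) → Set
ImbalancedPairs n C =
  Σ (Edge n × Edge n) λ { (e , e′) → Σ (Fin n) λ j → C (dir e) j × ImbalancedVia e e′ j }

module _ {C : Fin n → Fin n → Set}
         (C-functional : ∀ {i j j′} → C i j → C i j′ → j ≡ j′)
         (C-irrelevant : ∀ {i j} → Irrelevant (C i j)) where

  imbalancedPairs-≡ : (r r′ : ImbalancedPairs n C) →
                      proj₁ (proj₁ r) ≡ proj₁ (proj₁ r′) → r ≡ r′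
  imbalancedPairs-≡ ((e , e′₁) , j , c , at₁ , nf₁) ((.e , e′₂) , j′ , c′ , at₂ , nf₂) refl
    with refl ← C-functional c c′
    with refl ← isEdgeAt-unique {e₁ = e′₁} {e′₂} at₁ at₂
    rewrite C-irrelevant c c′ | isEdgeAt-irrelevant {e = e′₁} at₁ at₂ | Bool-≡-irrelevant nf₁ nf₂ = refl

insertAt-removeAt-≡ : {A : Set} (x : Vec A (suc n)) (i : Fin (suc n)) {b : A} →
                      lookup x i ≡ b → insertAt (removeAt x i) i b ≡ x
insertAt-removeAt-≡ x i refl = insertAt-removeAt x i

insertZeroEdge : (ε : Edge m) → Adjacent (dir ε) p q → Edge (suc m)
insertZeroEdge {p = p} {q = q} (z , _ , zₖ , fz , _) s =
  edge (insertAt z q false) p (trans (lookup-insertAt-adjacent s z false) zₖ) (fib-insertAt-false z q fz)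

insertZeroEdge-imbalanced : (ε : Edge m) (s : Adjacent (dir ε) p q) →
                            ImbalancedVia (insertZeroEdge ε s) (insertZeroEdge ε (adjacent-sym s)) q
insertZeroEdge-imbalanced {p = p} {q = q} (z , _ , zₖ , _) s =
  (refl , inj₂ (sym (hop s z zₖ))) , adjacent-ones-notFib s (flip x q) x′ₚ x′_q
  where
  x = insertAt z q false
  x′ₚ : lookup (flip x q) p ≡ true
  x′ₚ = trans (lookup-flip-≢ x (adjacent-≢ s)) (trans (lookup-insertAt-adjacent s z false) zₖ)
  x′_q : lookup (flip x q) q ≡ true
  x′_q = trans (lookup-flip x q) (cong not (insertAt-lookup z q false))

isEdgeAt-adjacent-upper : (e e′ : Edge (suc m)) → Adjacent k (dir e) q → IsEdgeAt e′ (lower e) q →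
                          upper e′ ≡ flip (flip (upper e) (dir e)) q
isEdgeAt-adjacent-upper e            (_ , _ , _) s (refl , inj₂ eq) = eq
isEdgeAt-adjacent-upper (x , p , xₚ , fx , _) (_ , q , x′_q , _) s (refl , inj₁ refl)
  with () ← trans (sym x′_q)
                  (trans (lookup-flip-≢ x (adjacent-≢ (adjacent-sym s))) (fib-adjacent-zero s x fx xₚ))

insertAt-removeAt-upper : (e : Edge (suc m)) → Adjacent k (dir e) q →
                          insertAt (removeAt (upper e) q) q false ≡ upper e
insertAt-removeAt-upper {q = q} (x , _ , xₚ , fx , _) s =
  insertAt-removeAt-≡ x q (fib-adjacent-zero s x fx xₚ)

removeZeroEdge : (e e′ : Edge (suc m)) → Adjacent k (dir e) q → IsEdgeAt e′ (lower e) q → Edge m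
removeZeroEdge {k = k} {q = q} e@(x , p , xₚ , fx , _) e′@(_ , _ , _ , fx′ , _) s at =
  edge z k zₖ (fib-of-padded s z (subst IsFib x′≡ fx′) (subst IsFib (sym x≡) fx))
  where
  z = removeAt x q
  x≡ : insertAt z q false ≡ x
  x≡ = insertAt-removeAt-upper e s
  zₖ : lookup z k ≡ true
  zₖ = trans (lookup-removeAt-adjacent s x) xₚ
  x′≡ : upper e′ ≡ insertAt z p false
  x′≡ = begin
    upper e′                                ≡⟨ isEdgeAt-adjacent-upper e e′ s at ⟩
    flip (flip x p) q                       ≡⟨ cong (λ y → flip (flip y p) q) x≡ ⟨
    flip (flip (insertAt z q false) p) q    ≡⟨ hop s z zₖ ⟩
    insertAt z p false                      ∎
    where open ≡-Reasoning

toR : R (suc m) → Edge m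
toR ((e , e′) , suc k , c , at , _) = removeZeroEdge e e′ (adjacent-rightward (suc-injective c)) at

fromR : Edge m → R (suc m)
fromR ε = (insertZeroEdge ε rightward , insertZeroEdge ε leftward) ,
          suc (dir ε) , cong suc (sym (toℕ-inject₁ (dir ε))) , insertZeroEdge-imbalanced ε rightward

toR-fromR : (ε : Edge m) → toR (fromR ε) ≡ ε
toR-fromR ε = Edge-≡ (removeAt-insertAt (upper ε) (suc (dir ε)) false) refl

fromR-toR : (r : R (suc m)) → fromR (toR r) ≡ r
fromR-toR ((e , e′) , suc k , c , at , _) =
  imbalancedPairs-≡ (λ c c′ → toℕ-injective (trans c (sym c′))) ℕ-≡-irrelevant _ _
    (Edge-≡ (insertAt-removeAt-upper e (adjacent-rightward (suc-injective c)))
            (sym (toℕ-≡⇒inject₁ (suc-injective c))))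

R-bijection : R (suc m) ⤖ Edge m
R-bijection = ↔⇒⤖ (mk↔ₛ′ toR fromR toR-fromR fromR-toR)

toL : L (suc m) → Edge m
toL ((e@(_ , suc k , _) , e′) , j , c , at , _) =
  removeZeroEdge e e′ (adjacent-leftward (suc-injective c)) at

fromL : Edge m → L (suc m)
fromL ε = (insertZeroEdge ε leftward , insertZeroEdge ε rightward) ,
          inject₁ (dir ε) , cong suc (sym (toℕ-inject₁ (dir ε))) , insertZeroEdge-imbalanced ε leftward

toL-fromL : (ε : Edge m) → toL (fromL ε) ≡ ε
toL-fromL ε = Edge-≡ (removeAt-insertAt (upper ε) (inject₁ (dir ε)) false) refl

fromL-toL : (r : L (suc m)) → fromL (toL r) ≡ r
-- The 0 was removed at j but fromL re-inserts it at inject₁ k; these must first be identified.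
fromL-toL ((e@(_ , suc k , _) , e′) , j , c , at , _)
  with refl ← toℕ-≡⇒inject₁ (suc-injective c) =
  imbalancedPairs-≡ (λ c c′ → toℕ-injective (suc-injective (trans (sym c) c′))) ℕ-≡-irrelevant _ _
    (Edge-≡ (insertAt-removeAt-upper e leftward) refl)

L-bijection : L (suc m) ⤖ Edge m
L-bijection = ↔⇒⤖ (mk↔ₛ′ toL fromL toL-fromL fromL-toL)

mainTheorem2 : (n : ℕ) → 2 ≤ n → (R n ⤖ Edge (n ∸ 1)) × (L n ⤖ Edge (n ∸ 1))
mainTheorem2 (suc (suc m)) _         = R-bijection , L-bijection
mainTheorem2 (suc zero)    (s≤s ())
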